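{- For any positive integers $a,b,n$, $$\sum_{m=1}^nd_m(t)\,z_{b+(m-1)a}\ast_t z_a^{n-m}=\sum_{m=0}^{n-1}z_a^mz_bz_a^{n-1-m}.$$
   Context: Let $\mathfrak{h}_t=\mathbb{Q}[t]\langle x,y\rangle$ ($t$ a variable) be the noncommutative polynomial algebra in letters $x,y$, $\mathfrak{h}_t^1=\mathbb{Q}[t]+\mathfrak{h}_ty$, $z_k=x^{k-1}y$; $z_a^m$ is a concatenation power. The $t$-harmonic product $\ast_t$ on $\mathfrak{h}_t^1$ is $\mathbb{Q}[t]$-bilinear with $1\ast_tw=w\ast_t1=w$ and $z_kw_1\ast_t z_lw_2=z_k(w_1\ast_t z_lw_2)+z_l(z_kw_1\ast_t w_2)+(1-2t)z_{k+l}(w_1\ast_t w_2)+[1-\delta(w_1)\delta(w_2)](t^2-t)x^{k+l}(w_1\ast_t w_2)$ for words $w_1,w_2\in\mathfrak{h}_t^1$, $k,l\geq1$, where $\delta(w)=1$ if $w=1$ and $0$ otherwise. For $m\geq1$, $d_m(t)=t^m-(t-1)^m$. -}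

module Defs where

open import Data.Nat using (ℕ; zero; suc; _≟_) renaming (_+_ to _+ℕ_; _∸_ to _∸ℕ_)
open import Data.Rational using (ℚ; 0ℚ; 1ℚ; _+_; _*_; -_)
open import Data.List using (List; []; _∷_; _++_; map; concatMap; replicate; applyUpTo; concat)
open import Data.Product using (_×_; _,_)
open import Data.Bool using (Bool; true; false; if_then_else_; _∧_)
open import Relation.Nullary.Decidable using (⌊_⌋)
open import Relation.Binary.PropositionalEquality using (_≡_)
open import Data.List.Properties using (≡-dec)
import Relation.Nullary
import Data.Nat

data Letter : Set where
  x y : Letter

_≟L_ : (a b : Letter) → Relation.Nullary.Dec (a ≡ b)
x ≟L x = Relation.Nullary.yes Relation.Binary.PropositionalEquality.refl
x ≟L y = Relation.Nullary.no (λ ())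
y ≟L x = Relation.Nullary.no (λ ())
y ≟L y = Relation.Nullary.yes Relation.Binary.PropositionalEquality.refl

Word : Set
Word = List Letter

_≟W_ : (u v : Word) → Relation.Nullary.Dec (u ≡ v)
_≟W_ = ≡-dec _≟L_

-- z_k = x^{k-1} y   (used for k ≥ 1)
z : ℕ → Word
z k = replicate (k ∸ℕ 1) x ++ (y ∷ [])

-- word of h^1 given by its index list (k₁ … k_r) ↦ z_{k₁} ⋯ z_{k_r}
zw : List ℕ → Word
zw [] = []
zw (k ∷ ks) = z k ++ zw ks

-- Polynomials in t over ℚ: finite formal sums  Σ c t^j
TPoly : Set
TPoly = List (ℚ × ℕ)

_·t_ : TPoly → TPoly → TPoly
p ·t q = concatMap (λ { (c , i) → map (λ { (d , j) → (c * d , i +ℕ j) }) q }) p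

_^t_ : TPoly → ℕ → TPoly
p ^t zero = (1ℚ , 0) ∷ []
p ^t suc m = p ·t (p ^t m)

negT : TPoly → TPoly
negT = map (λ { (c , i) → (- c , i) })

tT : TPoly
tT = (1ℚ , 1) ∷ []

d : ℕ → TPoly
d m = (tT ^t m) ++ negT ((tT ++ ((- 1ℚ , 0) ∷ [])) ^t m)

-- Elements of 𝔥_t : finite formal sums Σ c t^j w
Poly : Set
Poly = List (ℚ × ℕ × Word)

scale : TPoly → Poly → Poly
scale p f = concatMap (λ { (c , i) → map (λ { (e , j , w) → (c * e , i +ℕ j , w) }) f }) p

pre : Word → Poly → Poly
pre u = map (λ { (e , j , w) → (e , j , u ++ w) })

wordP : Word → Poly
wordP w = (1ℚ , 0 , w) ∷ []

isEmpty : List ℕ → Bool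
isEmpty [] = true
isEmpty (_ ∷ _) = false

oneMinus2t : TPoly
oneMinus2t = (1ℚ , 0) ∷ (- (1ℚ + 1ℚ) , 1) ∷ []

t²-t : TPoly
t²-t = (1ℚ , 2) ∷ (- 1ℚ , 1) ∷ []

_⋆_ : List ℕ → List ℕ → Poly
[] ⋆ v = wordP (zw v)
(k ∷ u) ⋆ [] = wordP (zw (k ∷ u))
(k ∷ u) ⋆ (l ∷ v) =
  pre (z k) (u ⋆ (l ∷ v))
  ++ pre (z l) ((k ∷ u) ⋆ v)
  ++ scale oneMinus2t (pre (z (k +ℕ l)) (u ⋆ v))
  ++ (if isEmpty u ∧ isEmpty v then []
      else scale t²-t (pre (replicate (k +ℕ l) x) (u ⋆ v)))

coeff : Poly → ℕ → Word → ℚ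
coeff [] j w = 0ℚ
coeff ((c , i , u) ∷ f) j w =
  (if ⌊ i ≟ j ⌋ ∧ ⌊ u ≟W w ⌋ then c else 0ℚ) + coeff f j w

_≈_ : Poly → Poly → Set
f ≈ g = ∀ j w → coeff f j w ≡ coeff g j w

lhs : ℕ → ℕ → ℕ → Poly
lhs a b n = concat (applyUpTo (λ i →
  let m = suc i in
  scale (d m) ((b +ℕ (i Data.Nat.* a) ∷ []) ⋆ replicate (n ∸ℕ m) a)) n)

rhs : ℕ → ℕ → ℕ → Poly
rhs a b n = concat (applyUpTo (λ m →
  wordP (zw (replicate m a ++ (b ∷ []) ++ replicate (n ∸ℕ 1 ∸ℕ m) a))) n)

{-# OPTIONS --safe #-}
module Submission where

-- Peeling off the letter z_a that the right factor contributes first,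
--   z_c ∗ z_a^k = z_a (z_c ∗ z_a^(k-1)) + h(c,k),
--   h(c,k) = z_c z_a^k + (1-2t) z_(c+a) z_a^(k-1) + (t²-t) z_(c+2a) z_a^(k-2)
-- (terms with negative exponents absent). Hence
--   LHS(n+1) = z_a LHS(n) + Σ_{i+k=n} d_(i+1) h(b+ia,k),
-- and by induction it remains to see that the antidiagonal sum is z_b z_a^n. Grouped by
-- the words z_(b+ma) z_a^(n-m), its coefficients are d_(m+1) + (1-2t) d_m + (t²-t) d_(m-1),
-- which vanish for m ≥ 1 because t and t-1 are the roots of X² + (1-2t) X + (t²-t);
-- only d_1 = 1 survives.
-- Polynomials in t act on coefficient sequences in powers of t (multiplication by t is
-- the shift), and elements of 𝔥_t are compared coefficientwise.

open import Defs
open import Level using (0ℓ)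
open import Data.Bool using (Bool; true; false; if_then_else_; _∧_)
open import Data.Bool.Properties using (∧-zeroʳ)
open import Data.Nat using (ℕ; zero; suc; _≤_)
  renaming (_+_ to _+ℕ_; _*_ to _*ℕ_; _∸_ to _∸ℕ_; _≟_ to _≟ℕ_)
import Data.Nat.Properties as ℕ
open import Data.Rational using (ℚ; 0ℚ; 1ℚ; _+_; _*_; -_; _-_)
open import Data.Rational.Properties
  using (+-*-commutativeRing; _≟_; +-identityˡ; +-identityʳ; +-assoc; +-comm; *-zeroʳ; *-distribˡ-+)
open import Data.List using (List; []; _∷_; _++_; map; replicate; applyUpTo; concat)
open import Data.List.Properties
  using (map-++; ++-assoc; ++-identityʳ; ++-cancelˡ; ∷-injectiveˡ; ∷-injectiveʳ)
open import Data.Product using (_,_; ∃-syntax)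
open import Data.Sum using (_⊎_; inj₁; inj₂)
open import Algebra using (CommutativeMonoid; IsCommutativeMonoid)
open import Relation.Binary using (IsEquivalence)
import Relation.Binary.Reasoning.Setoid as ≈-Reasoning
open import Function using (const; _∘_; _⇔_; mk⇔)
open import Relation.Nullary using (Dec; yes; no)
open import Relation.Nullary.Decidable using (⌊_⌋; dec⇒maybe; isYes≗does; does-⇔; dec-false)
open import Relation.Binary.PropositionalEquality
  using (_≡_; _≢_; refl; sym; trans; cong; cong₂; subst; _≗_; module ≡-Reasoning)
open import Tactic.RingSolver using (solve)
import Tactic.RingSolver.Core.AlmostCommutativeRing as ACR

ℚ-ring : ACR.AlmostCommutativeRing 0ℓ 0ℓ
ℚ-ring = ACR.fromCommutativeRing +-*-commutativeRing (λ q → dec⇒maybe (0ℚ ≟ q))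

Seq : Set
Seq = ℕ → ℚ

shift : Seq → Seq
shift s zero = 0ℚ
shift s (suc j) = s j

shift^ : ℕ → Seq → Seq
shift^ zero s = s
shift^ (suc i) s = shift (shift^ i s)

infixr 5 _▷_
_▷_ : TPoly → Seq → Seq
([] ▷ s) j = 0ℚ
(((c , i) ∷ p) ▷ s) j = c * shift^ i s j + (p ▷ s) j

shift^-cong : ∀ i {s s′} → s ≗ s′ → shift^ i s ≗ shift^ i s′
shift^-cong zero eq j = eq j
shift^-cong (suc i) eq zero = refl
shift^-cong (suc i) eq (suc j) = shift^-cong i eq j

shift^-0 : ∀ i → shift^ i (const 0ℚ) ≗ const 0ℚ
shift^-0 zero j = refl
shift^-0 (suc i) zero = refl
shift^-0 (suc i) (suc j) = shift^-0 i j

shift^-+ : ∀ i s s′ j → shift^ i (λ k → s k + s′ k) j ≡ shift^ i s j + shift^ i s′ j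
shift^-+ zero s s′ j = refl
shift^-+ (suc i) s s′ zero = sym (+-identityʳ 0ℚ)
shift^-+ (suc i) s s′ (suc j) = shift^-+ i s s′ j

shift^-* : ∀ i c s j → shift^ i (λ k → c * s k) j ≡ c * shift^ i s j
shift^-* zero c s j = refl
shift^-* (suc i) c s zero = sym (*-zeroʳ c)
shift^-* (suc i) c s (suc j) = shift^-* i c s j

shift^-+ℕ : ∀ i k s → shift^ (i +ℕ k) s ≗ shift^ i (shift^ k s)
shift^-+ℕ zero k s j = refl
shift^-+ℕ (suc i) k s zero = refl
shift^-+ℕ (suc i) k s (suc j) = shift^-+ℕ i k s j

▷-cong : ∀ p {s s′} → s ≗ s′ → p ▷ s ≗ p ▷ s′
▷-cong [] eq j = refl
▷-cong ((c , i) ∷ p) eq j = cong₂ _+_ (cong (c *_) (shift^-cong i eq j)) (▷-cong p eq j)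

▷-0 : ∀ p → p ▷ const 0ℚ ≗ const 0ℚ
▷-0 [] j = refl
▷-0 ((c , i) ∷ p) j rewrite shift^-0 i j | ▷-0 p j = cong (_+ 0ℚ) (*-zeroʳ c)

▷-+ : ∀ p s s′ j → (p ▷ (λ k → s k + s′ k)) j ≡ (p ▷ s) j + (p ▷ s′) j
▷-+ [] s s′ j = sym (+-identityʳ 0ℚ)
▷-+ ((c , i) ∷ p) s s′ j rewrite shift^-+ i s s′ j | ▷-+ p s s′ j
  with shift^ i s j | shift^ i s′ j | (p ▷ s) j | (p ▷ s′) j
... | u | u′ | v | v′ = solve (c ∷ u ∷ u′ ∷ v ∷ v′ ∷ []) ℚ-ring

▷-++ : ∀ p q s j → ((p ++ q) ▷ s) j ≡ (p ▷ s) j + (q ▷ s) j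
▷-++ [] q s j = sym (+-identityˡ _)
▷-++ ((c , i) ∷ p) q s j rewrite ▷-++ p q s j
  with shift^ i s j | (p ▷ s) j | (q ▷ s) j
... | u | v | w = solve (c ∷ u ∷ v ∷ w ∷ []) ℚ-ring

▷-negT : ∀ p s j → (negT p ▷ s) j ≡ - (p ▷ s) j
▷-negT [] s j = refl
▷-negT ((c , i) ∷ p) s j rewrite ▷-negT p s j with shift^ i s j | (p ▷ s) j
... | u | v = solve (c ∷ u ∷ v ∷ []) ℚ-ring

▷-map-monomial : ∀ c i q s j →
  (map (λ (d , k) → (c * d , i +ℕ k)) q ▷ s) j ≡ c * shift^ i (q ▷ s) j
▷-map-monomial c i [] s j = sym (trans (cong (c *_) (shift^-0 i j)) (*-zeroʳ c))
▷-map-monomial c i ((d , k) ∷ q) s j = begin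
  (c * d) * shift^ (i +ℕ k) s j + (map (λ (d , k) → (c * d , i +ℕ k)) q ▷ s) j
    ≡⟨ cong₂ _+_ (cong ((c * d) *_) (shift^-+ℕ i k s j)) (▷-map-monomial c i q s j) ⟩
  (c * d) * shift^ i (shift^ k s) j + c * shift^ i (q ▷ s) j
    ≡⟨ factor-c (shift^ i (shift^ k s) j) (shift^ i (q ▷ s) j) ⟩
  c * (d * shift^ i (shift^ k s) j + shift^ i (q ▷ s) j)
    ≡⟨ cong (c *_) (trans (shift^-+ i _ (q ▷ s) j) (cong (_+ _) (shift^-* i d (shift^ k s) j))) ⟨
  c * shift^ i (((d , k) ∷ q) ▷ s) j ∎
  where
  open ≡-Reasoning
  factor-c : ∀ u v → (c * d) * u + c * v ≡ c * (d * u + v)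
  factor-c u v = solve (c ∷ d ∷ u ∷ v ∷ []) ℚ-ring

▷-·t : ∀ p q s → (p ·t q) ▷ s ≗ p ▷ (q ▷ s)
▷-·t [] q s j = refl
▷-·t ((c , i) ∷ p) q s j =
  trans (▷-++ (map (λ (d , k) → (c * d , i +ℕ k)) q) (p ·t q) s j)
        (cong₂ _+_ (▷-map-monomial c i q s j) (▷-·t p q s j))

recurrence : (ℕ → TPoly) → ℕ → Seq → Seq
recurrence e k s j =
  (e k ▷ t²-t ▷ s) j + ((e (suc k) ▷ oneMinus2t ▷ s) j + (e (suc (suc k)) ▷ s) j)

Recurrent : (ℕ → TPoly) → Set
Recurrent e = ∀ k s → recurrence e k s ≗ const 0ℚ

powers-recurrent : ∀ P → (∀ s → recurrence (P ^t_) 0 s ≗ const 0ℚ) → Recurrent (P ^t_)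
powers-recurrent P root zero s = root s
powers-recurrent P root (suc k) s j = begin
  recurrence (P ^t_) (suc k) s j
    ≡⟨ cong₂ _+_ (▷-·t P _ _ j) (cong₂ _+_ (▷-·t P _ _ j) (▷-·t P _ s j)) ⟩
  (P ▷ A) j + ((P ▷ B) j + (P ▷ C) j)
    ≡⟨ trans (▷-+ P A _ j) (cong ((P ▷ A) j +_) (▷-+ P B C j)) ⟨
  (P ▷ recurrence (P ^t_) k s) j
    ≡⟨ ▷-cong P (powers-recurrent P root k s) j ⟩
  (P ▷ const 0ℚ) j
    ≡⟨ ▷-0 P j ⟩
  0ℚ ∎
  where
  open ≡-Reasoning
  A = (P ^t k) ▷ t²-t ▷ s
  B = (P ^t suc k) ▷ oneMinus2t ▷ s
  C = (P ^t suc (suc k)) ▷ s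

t-root : ∀ s → recurrence (tT ^t_) 0 s ≗ const 0ℚ
t-root s zero = refl
t-root s (suc zero) with s 0
... | u = solve (u ∷ []) ℚ-ring
t-root s (suc (suc j)) with s j | s (suc j)
... | u | v = solve (u ∷ v ∷ []) ℚ-ring

t-1 : TPoly
t-1 = tT ++ ((- 1ℚ , 0) ∷ [])

t-1-root : ∀ s → recurrence (t-1 ^t_) 0 s ≗ const 0ℚ
t-1-root s zero with s 0
... | u = solve (u ∷ []) ℚ-ring
t-1-root s (suc zero) with s 0 | s 1
... | u | v = solve (u ∷ v ∷ []) ℚ-ring
t-1-root s (suc (suc j)) with s j | s (suc j) | s (suc (suc j))
... | u | v | w = solve (u ∷ v ∷ w ∷ []) ℚ-ring

▷-d : ∀ m s j → (d m ▷ s) j ≡ (tT ^t m ▷ s) j - (t-1 ^t m ▷ s) j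
▷-d m s j = trans (▷-++ (tT ^t m) _ s j) (cong ((tT ^t m ▷ s) j +_) (▷-negT (t-1 ^t m) s j))

recurrent-difference : ∀ {e f g} → (∀ m s j → (e m ▷ s) j ≡ (f m ▷ s) j - (g m ▷ s) j) →
  Recurrent f → Recurrent g → Recurrent e
recurrent-difference {e} {f} {g} e≡f-g f-rec g-rec k s j = begin
  recurrence e k s j
    ≡⟨ cong₂ _+_ (e≡f-g k _ j) (cong₂ _+_ (e≡f-g (suc k) _ j) (e≡f-g (suc (suc k)) s j)) ⟩
  (f₀ - g₀) + ((f₁ - g₁) + (f₂ - g₂))
    ≡⟨ regroup f₀ g₀ f₁ g₁ f₂ g₂ ⟩
  recurrence f k s j - recurrence g k s j
    ≡⟨ cong₂ _-_ (f-rec k s j) (g-rec k s j) ⟩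
  0ℚ - 0ℚ ≡⟨⟩
  0ℚ ∎
  where
  open ≡-Reasoning
  f₀ = (f k ▷ t²-t ▷ s) j
  f₁ = (f (suc k) ▷ oneMinus2t ▷ s) j
  f₂ = (f (suc (suc k)) ▷ s) j
  g₀ = (g k ▷ t²-t ▷ s) j
  g₁ = (g (suc k) ▷ oneMinus2t ▷ s) j
  g₂ = (g (suc (suc k)) ▷ s) j
  regroup : ∀ a₀ b₀ a₁ b₁ a₂ b₂ →
    (a₀ - b₀) + ((a₁ - b₁) + (a₂ - b₂)) ≡ (a₀ + (a₁ + a₂)) - (b₀ + (b₁ + b₂))
  regroup a₀ b₀ a₁ b₁ a₂ b₂ = solve (a₀ ∷ b₀ ∷ a₁ ∷ b₁ ∷ a₂ ∷ b₂ ∷ []) ℚ-ring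

d-recurrent : Recurrent d
d-recurrent = recurrent-difference {d} {tT ^t_} {t-1 ^t_} ▷-d
  (powers-recurrent tT t-root) (powers-recurrent t-1 t-1-root)

▷-d0 : ∀ s → d 0 ▷ s ≗ const 0ℚ
▷-d0 s j with s j
... | u = solve (u ∷ []) ℚ-ring

▷-d1 : ∀ s → d 1 ▷ s ≗ s
▷-d1 s j with s j | shift s j
... | u | v = solve (u ∷ v ∷ []) ℚ-ring

⌊⌋-⇔ : ∀ {A B : Set} → A ⇔ B → (a? : Dec A) (b? : Dec B) → ⌊ a? ⌋ ≡ ⌊ b? ⌋
⌊⌋-⇔ A⇔B a? b? = trans (isYes≗does a?) (trans (does-⇔ A⇔B a? b?) (sym (isYes≗does b?)))

shift^-indicator : ∀ i k (b : Bool) e →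
  shift^ i (λ k′ → if ⌊ k ≟ℕ k′ ⌋ ∧ b then e else 0ℚ)
    ≗ (λ j → if ⌊ i +ℕ k ≟ℕ j ⌋ ∧ b then e else 0ℚ)
shift^-indicator zero k b e j = refl
shift^-indicator (suc i) k b e zero = refl
shift^-indicator (suc i) k b e (suc j) =
  trans (shift^-indicator i k b e j)
        (cong (λ b′ → if b′ ∧ b then e else 0ℚ) (⌊⌋-⇔ (mk⇔ (cong suc) ℕ.suc-injective) _ _))

⟦_⟧ : Poly → Word → Seq
⟦ f ⟧ w j = coeff f j w

coeff-++ : ∀ f g w j → ⟦ f ++ g ⟧ w j ≡ ⟦ f ⟧ w j + ⟦ g ⟧ w j
coeff-++ [] g w j = sym (+-identityˡ _)
coeff-++ ((c , i , u) ∷ f) g w j =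
  trans (cong (m +_) (coeff-++ f g w j)) (sym (+-assoc m (⟦ f ⟧ w j) (⟦ g ⟧ w j)))
  where m = if ⌊ i ≟ℕ j ⌋ ∧ ⌊ u ≟W w ⌋ then c else 0ℚ

coeff-map-monomial : ∀ c i f w j →
  ⟦ map (λ (e , k , u) → (c * e , i +ℕ k , u)) f ⟧ w j ≡ c * shift^ i (⟦ f ⟧ w) j
coeff-map-monomial c i [] w j = sym (trans (cong (c *_) (shift^-0 i j)) (*-zeroʳ c))
coeff-map-monomial c i ((e , k , u) ∷ f) w j = begin
  (if ⌊ i +ℕ k ≟ℕ j ⌋ ∧ b then c * e else 0ℚ)
    + ⟦ map (λ (e , k , u) → (c * e , i +ℕ k , u)) f ⟧ w j
    ≡⟨ cong₂ _+_ (pull-c (⌊ i +ℕ k ≟ℕ j ⌋ ∧ b)) (coeff-map-monomial c i f w j) ⟩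
  c * (if ⌊ i +ℕ k ≟ℕ j ⌋ ∧ b then e else 0ℚ) + c * shift^ i (⟦ f ⟧ w) j
    ≡⟨ *-distribˡ-+ c _ _ ⟨
  c * ((if ⌊ i +ℕ k ≟ℕ j ⌋ ∧ b then e else 0ℚ) + shift^ i (⟦ f ⟧ w) j)
    ≡⟨ cong (c *_) (trans (shift^-+ i _ (⟦ f ⟧ w) j) (cong (_+ _) (shift^-indicator i k b e j))) ⟨
  c * shift^ i (⟦ (e , k , u) ∷ f ⟧ w) j ∎
  where
  open ≡-Reasoning
  b = ⌊ u ≟W w ⌋
  pull-c : ∀ β → (if β then c * e else 0ℚ) ≡ c * (if β then e else 0ℚ)
  pull-c true = refl
  pull-c false = sym (*-zeroʳ c)

coeff-scale : ∀ p f w → ⟦ scale p f ⟧ w ≗ p ▷ ⟦ f ⟧ w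
coeff-scale [] f w j = refl
coeff-scale ((c , i) ∷ p) f w j =
  trans (coeff-++ (map (λ (e , k , u) → (c * e , i +ℕ k , u)) f) (scale p f) w j)
        (cong₂ _+_ (coeff-map-monomial c i f w j) (coeff-scale p f w j))

prefix-or-not : (u w : Word) → (∃[ v ] w ≡ u ++ v) ⊎ (∀ v → u ++ v ≢ w)
prefix-or-not [] w = inj₁ (w , refl)
prefix-or-not (l ∷ u) [] = inj₂ (λ v ())
prefix-or-not (l ∷ u) (l′ ∷ w) with l ≟L l′ | prefix-or-not u w
... | no l≢l′ | _ = inj₂ (λ v eq → l≢l′ (∷-injectiveˡ eq))
... | yes refl | inj₁ (v , refl) = inj₁ (v , refl)
... | yes refl | inj₂ u⋢w = inj₂ (λ v eq → u⋢w v (∷-injectiveʳ eq))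

coeff-pre-++ : ∀ u f v → ⟦ pre u f ⟧ (u ++ v) ≗ ⟦ f ⟧ v
coeff-pre-++ u [] v j = refl
coeff-pre-++ u ((e , k , v′) ∷ f) v j =
  cong₂ (λ b r → (if ⌊ k ≟ℕ j ⌋ ∧ b then e else 0ℚ) + r)
        (⌊⌋-⇔ (mk⇔ (++-cancelˡ u v′ v) (cong (u ++_))) ((u ++ v′) ≟W (u ++ v)) (v′ ≟W v))
        (coeff-pre-++ u f v j)

coeff-pre-nonprefix : ∀ u f w → (∀ v → u ++ v ≢ w) → ⟦ pre u f ⟧ w ≗ const 0ℚ
coeff-pre-nonprefix u [] w u⋢w j = refl
coeff-pre-nonprefix u ((e , k , v) ∷ f) w u⋢w j = begin
  (if ⌊ k ≟ℕ j ⌋ ∧ ⌊ (u ++ v) ≟W w ⌋ then e else 0ℚ) + ⟦ pre u f ⟧ w j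
    ≡⟨ cong₂ (λ b r → (if ⌊ k ≟ℕ j ⌋ ∧ b then e else 0ℚ) + r)
             (trans (isYes≗does ((u ++ v) ≟W w)) (dec-false ((u ++ v) ≟W w) (u⋢w v)))
             (coeff-pre-nonprefix u f w u⋢w j) ⟩
  (if ⌊ k ≟ℕ j ⌋ ∧ false then e else 0ℚ) + 0ℚ
    ≡⟨ cong (λ b → (if b then e else 0ℚ) + 0ℚ) (∧-zeroʳ ⌊ k ≟ℕ j ⌋) ⟩
  0ℚ ∎
  where open ≡-Reasoning

infix 4 _≋_
record _≋_ (f g : Poly) : Set where
  constructor mk≋
  field coeffs-≗ : ∀ w → ⟦ f ⟧ w ≗ ⟦ g ⟧ w
open _≋_

≋-isEquivalence : IsEquivalence _≋_
≋-isEquivalence = record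
  { refl = mk≋ λ w j → refl
  ; sym = λ f≋g → mk≋ λ w j → sym (coeffs-≗ f≋g w j)
  ; trans = λ f≋g g≋h → mk≋ λ w j → trans (coeffs-≗ f≋g w j) (coeffs-≗ g≋h w j)
  }

++-cong : ∀ {f f′ g g′} → f ≋ f′ → g ≋ g′ → f ++ g ≋ f′ ++ g′
++-cong {f} {f′} {g} {g′} f≋f′ g≋g′ = mk≋ λ w j → begin
  ⟦ f ++ g ⟧ w j            ≡⟨ coeff-++ f g w j ⟩
  ⟦ f ⟧ w j + ⟦ g ⟧ w j     ≡⟨ cong₂ _+_ (coeffs-≗ f≋f′ w j) (coeffs-≗ g≋g′ w j) ⟩
  ⟦ f′ ⟧ w j + ⟦ g′ ⟧ w j   ≡⟨ coeff-++ f′ g′ w j ⟨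
  ⟦ f′ ++ g′ ⟧ w j          ∎
  where open ≡-Reasoning

++-congˡ : ∀ f {g g′} → g ≋ g′ → f ++ g ≋ f ++ g′
++-congˡ f = ++-cong {f} {f} (mk≋ λ w j → refl)

++-congʳ : ∀ {f f′} g → f ≋ f′ → f ++ g ≋ f′ ++ g
++-congʳ {f} {f′} g f≋f′ = ++-cong {f} {f′} {g} {g} f≋f′ (mk≋ λ w j → refl)

++-comm : ∀ f g → f ++ g ≋ g ++ f
++-comm f g = mk≋ λ w j →
  trans (coeff-++ f g w j) (trans (+-comm (⟦ f ⟧ w j) (⟦ g ⟧ w j)) (sym (coeff-++ g f w j)))

++-isCommutativeMonoid : IsCommutativeMonoid _≋_ _++_ []
++-isCommutativeMonoid = record
  { isMonoid = record
    { isSemigroup = record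
      { isMagma = record { isEquivalence = ≋-isEquivalence ; ∙-cong = ++-cong }
      ; assoc = λ f g h → IsEquivalence.reflexive ≋-isEquivalence (++-assoc f g h)
      }
    ; identity = (λ f → IsEquivalence.refl ≋-isEquivalence)
               , (λ f → IsEquivalence.reflexive ≋-isEquivalence (++-identityʳ f))
    }
  ; comm = ++-comm
  }

++-commutativeMonoid : CommutativeMonoid 0ℓ 0ℓ
++-commutativeMonoid = record { isCommutativeMonoid = ++-isCommutativeMonoid }

open CommutativeMonoid ++-commutativeMonoid
  using () renaming (setoid to ≋-setoid; refl to ≋-refl; trans to ≋-trans; reflexive to ≡⇒≋)
open import Algebra.Properties.CommutativeSemigroup (CommutativeMonoid.commutativeSemigroup ++-commutativeMonoid)
  using (interchange; x∙yz≈y∙xz)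

scale-cong : ∀ p {f g} → f ≋ g → scale p f ≋ scale p g
scale-cong p {f} {g} f≋g = mk≋ λ w j → begin
  ⟦ scale p f ⟧ w j   ≡⟨ coeff-scale p f w j ⟩
  (p ▷ ⟦ f ⟧ w) j     ≡⟨ ▷-cong p (coeffs-≗ f≋g w) j ⟩
  (p ▷ ⟦ g ⟧ w) j     ≡⟨ coeff-scale p g w j ⟨
  ⟦ scale p g ⟧ w j   ∎
  where open ≡-Reasoning

scale-++ : ∀ p f g → scale p (f ++ g) ≋ scale p f ++ scale p g
scale-++ p f g = mk≋ λ w j → begin
  ⟦ scale p (f ++ g) ⟧ w j                   ≡⟨ coeff-scale p (f ++ g) w j ⟩
  (p ▷ ⟦ f ++ g ⟧ w) j                       ≡⟨ ▷-cong p (coeff-++ f g w) j ⟩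
  (p ▷ (λ k → ⟦ f ⟧ w k + ⟦ g ⟧ w k)) j     ≡⟨ ▷-+ p (⟦ f ⟧ w) (⟦ g ⟧ w) j ⟩
  (p ▷ ⟦ f ⟧ w) j + (p ▷ ⟦ g ⟧ w) j         ≡⟨ cong₂ _+_ (coeff-scale p f w j) (coeff-scale p g w j) ⟨
  ⟦ scale p f ⟧ w j + ⟦ scale p g ⟧ w j     ≡⟨ coeff-++ (scale p f) (scale p g) w j ⟨
  ⟦ scale p f ++ scale p g ⟧ w j            ∎
  where open ≡-Reasoning

scale-[] : ∀ p → scale p [] ≋ []
scale-[] p = mk≋ λ w j → trans (coeff-scale p [] w j) (▷-0 p j)

scale-d0 : ∀ f → scale (d 0) f ≋ []
scale-d0 f = mk≋ λ w j → trans (coeff-scale (d 0) f w j) (▷-d0 (⟦ f ⟧ w) j)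

scale-d1 : ∀ f → scale (d 1) f ≋ f
scale-d1 f = mk≋ λ w j → trans (coeff-scale (d 1) f w j) (▷-d1 (⟦ f ⟧ w) j)

recurrent-scale : ∀ {e} → Recurrent e → ∀ k X →
  scale (e k) (scale t²-t X) ++ (scale (e (suc k)) (scale oneMinus2t X) ++ scale (e (suc (suc k))) X) ≋ []
recurrent-scale {e} e-rec k X = mk≋ λ w j → begin
  ⟦ E₀ ++ (E₁ ++ E₂) ⟧ w j
    ≡⟨ trans (coeff-++ E₀ _ w j) (cong (⟦ E₀ ⟧ w j +_) (coeff-++ E₁ E₂ w j)) ⟩
  ⟦ E₀ ⟧ w j + (⟦ E₁ ⟧ w j + ⟦ E₂ ⟧ w j)
    ≡⟨ cong₂ _+_ (nested (e k) t²-t w j)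
                 (cong₂ _+_ (nested (e (suc k)) oneMinus2t w j) (coeff-scale (e (suc (suc k))) X w j)) ⟩
  recurrence e k (⟦ X ⟧ w) j
    ≡⟨ e-rec k (⟦ X ⟧ w) j ⟩
  0ℚ ∎
  where
  open ≡-Reasoning
  E₀ = scale (e k) (scale t²-t X)
  E₁ = scale (e (suc k)) (scale oneMinus2t X)
  E₂ = scale (e (suc (suc k))) X
  nested : ∀ p q w → ⟦ scale p (scale q X) ⟧ w ≗ p ▷ q ▷ ⟦ X ⟧ w
  nested p q w j = trans (coeff-scale p (scale q X) w j) (▷-cong p (coeff-scale q X w) j)

pre-++ : ∀ u f g → pre u (f ++ g) ≡ pre u f ++ pre u g
pre-++ u = map-++ _

pre-cong : ∀ u {f g} → f ≋ g → pre u f ≋ pre u g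
pre-cong u {f} {g} f≋g = mk≋ coeffs
  where
  coeffs : ∀ w → ⟦ pre u f ⟧ w ≗ ⟦ pre u g ⟧ w
  coeffs w j with prefix-or-not u w
  ... | inj₁ (v , refl) =
    trans (coeff-pre-++ u f v j) (trans (coeffs-≗ f≋g v j) (sym (coeff-pre-++ u g v j)))
  ... | inj₂ u⋢w = trans (coeff-pre-nonprefix u f w u⋢w j) (sym (coeff-pre-nonprefix u g w u⋢w j))

pre-scale : ∀ u p f → pre u (scale p f) ≋ scale p (pre u f)
pre-scale u p f = mk≋ coeffs
  where
  open ≡-Reasoning
  coeffs : ∀ w → ⟦ pre u (scale p f) ⟧ w ≗ ⟦ scale p (pre u f) ⟧ w
  coeffs w j with prefix-or-not u w
  ... | inj₁ (v , refl) = begin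
    ⟦ pre u (scale p f) ⟧ (u ++ v) j   ≡⟨ coeff-pre-++ u (scale p f) v j ⟩
    ⟦ scale p f ⟧ v j                  ≡⟨ coeff-scale p f v j ⟩
    (p ▷ ⟦ f ⟧ v) j                    ≡⟨ ▷-cong p (coeff-pre-++ u f v) j ⟨
    (p ▷ ⟦ pre u f ⟧ (u ++ v)) j       ≡⟨ coeff-scale p (pre u f) (u ++ v) j ⟨
    ⟦ scale p (pre u f) ⟧ (u ++ v) j   ∎
  ... | inj₂ u⋢w = begin
    ⟦ pre u (scale p f) ⟧ w j   ≡⟨ coeff-pre-nonprefix u (scale p f) w u⋢w j ⟩
    0ℚ                          ≡⟨ ▷-0 p j ⟨
    (p ▷ const 0ℚ) j            ≡⟨ ▷-cong p (coeff-pre-nonprefix u f w u⋢w) j ⟨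
    (p ▷ ⟦ pre u f ⟧ w) j       ≡⟨ coeff-scale p (pre u f) w j ⟨
    ⟦ scale p (pre u f) ⟧ w j   ∎

-- The sum of g i k over i + k = n - 1 (empty for n = 0); lhs a b n is definitionally such a sum.
antidiagonal : ℕ → (ℕ → ℕ → Poly) → Poly
antidiagonal n g = concat (applyUpTo (λ i → g i (n ∸ℕ suc i)) n)

antidiagonal-step : ∀ u {g h : ℕ → ℕ → Poly} → (∀ i → g i 0 ≋ h i 0) →
  (∀ i k → g i (suc k) ≋ pre u (g i k) ++ h i (suc k)) →
  ∀ n → antidiagonal (suc n) g ≋ pre u (antidiagonal n g) ++ antidiagonal (suc n) h
antidiagonal-step u base step zero = ++-cong (base 0) ≋-refl
antidiagonal-step u {g} {h} base step (suc n) = begin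
  g 0 (suc n) ++ antidiagonal (suc n) (g ∘ suc)
    ≈⟨ ++-cong (step 0 n) (antidiagonal-step u {g ∘ suc} {h ∘ suc} (base ∘ suc) (step ∘ suc) n) ⟩
  (pre u (g 0 n) ++ h 0 (suc n)) ++ (pre u (antidiagonal n (g ∘ suc)) ++ antidiagonal (suc n) (h ∘ suc))
    ≈⟨ interchange (pre u (g 0 n)) (h 0 (suc n)) (pre u (antidiagonal n (g ∘ suc))) _ ⟩
  (pre u (g 0 n) ++ pre u (antidiagonal n (g ∘ suc))) ++ (h 0 (suc n) ++ antidiagonal (suc n) (h ∘ suc))
    ≡⟨ cong (_++ _) (pre-++ u (g 0 n) _) ⟨
  pre u (antidiagonal (suc n) g) ++ antidiagonal (suc (suc n)) h ∎
  where open ≈-Reasoning ≋-setoid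

pre-Σ : ∀ u {f g : ℕ → Poly} → (∀ m → pre u (f m) ≡ g m) →
  ∀ n → pre u (concat (applyUpTo f n)) ≡ concat (applyUpTo g n)
pre-Σ u f≡g zero = refl
pre-Σ u {f} f≡g (suc n) =
  trans (pre-++ u (f 0) _) (cong₂ _++_ (f≡g 0) (pre-Σ u (f≡g ∘ suc) n))

replicate-+ : ∀ {A : Set} m n (v : A) → replicate (m +ℕ n) v ≡ replicate m v ++ replicate n v
replicate-+ zero n v = refl
replicate-+ (suc m) n v = cong (v ∷_) (replicate-+ m n v)

module HarmonicProduct (a : ℕ) (1≤a : 1 ≤ a) where

  aⁿ : ℕ → List ℕ
  aⁿ n = replicate n a

  word : List ℕ → Poly
  word ks = wordP (zw ks)

  xⁿ-z : ∀ n v → replicate n x ++ (z a ++ v) ≡ z (n +ℕ a) ++ v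
  xⁿ-z n v = begin
    replicate n x ++ ((replicate (a ∸ℕ 1) x ++ y ∷ []) ++ v)
      ≡⟨ ++-assoc (replicate n x) _ v ⟨
    (replicate n x ++ (replicate (a ∸ℕ 1) x ++ y ∷ [])) ++ v
      ≡⟨ cong (_++ v) (++-assoc (replicate n x) _ (y ∷ [])) ⟨
    ((replicate n x ++ replicate (a ∸ℕ 1) x) ++ y ∷ []) ++ v
      ≡⟨ cong (λ xs → (xs ++ y ∷ []) ++ v) (replicate-+ n (a ∸ℕ 1) x) ⟨
    (replicate (n +ℕ (a ∸ℕ 1)) x ++ y ∷ []) ++ v
      ≡⟨ cong (λ m → (replicate m x ++ y ∷ []) ++ v) (ℕ.+-∸-assoc n 1≤a) ⟨
    z (n +ℕ a) ++ v ∎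
    where open ≡-Reasoning

  t²-tTerm : ℕ → ℕ → Poly
  t²-tTerm c zero = []
  t²-tTerm c (suc k) = scale t²-t (word (c +ℕ a ∷ aⁿ k))

  ⋆-head : ℕ → ℕ → Poly
  ⋆-head c zero = word (c ∷ [])
  ⋆-head c (suc k) =
    word (c ∷ aⁿ (suc k)) ++ (scale oneMinus2t (word (c +ℕ a ∷ aⁿ k)) ++ t²-tTerm (c +ℕ a) k)

  ⋆-step : ∀ c k → (c ∷ []) ⋆ aⁿ (suc k) ≋ pre (z a) ((c ∷ []) ⋆ aⁿ k) ++ ⋆-head c (suc k)
  ⋆-step c zero =
    x∙yz≈y∙xz (word (c ∷ aⁿ 1)) (pre (z a) (word (c ∷ [])))
              (scale oneMinus2t (word (c +ℕ a ∷ [])) ++ [])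
  ⋆-step c (suc k) = begin
    (c ∷ []) ⋆ aⁿ (suc (suc k))
      ≡⟨ cong (λ v → word (c ∷ aⁿ (suc (suc k))) ++ (pre (z a) ((c ∷ []) ⋆ aⁿ (suc k))
                 ++ (scale oneMinus2t (word (c +ℕ a ∷ aⁿ (suc k))) ++ scale t²-t (wordP v))))
              (xⁿ-z (c +ℕ a) (zw (aⁿ k))) ⟩
    word (c ∷ aⁿ (suc (suc k))) ++ (pre (z a) ((c ∷ []) ⋆ aⁿ (suc k)) ++ rest)
      ≈⟨ x∙yz≈y∙xz (word (c ∷ aⁿ (suc (suc k)))) (pre (z a) ((c ∷ []) ⋆ aⁿ (suc k))) rest ⟩
    pre (z a) ((c ∷ []) ⋆ aⁿ (suc k)) ++ ⋆-head c (suc (suc k)) ∎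
    where
    open ≈-Reasoning ≋-setoid
    rest = scale oneMinus2t (word (c +ℕ a ∷ aⁿ (suc k))) ++ t²-tTerm (c +ℕ a) (suc k)

  weightedHead : (ℕ → TPoly) → (ℕ → ℕ) → ℕ → ℕ → Poly
  weightedHead e c i k = scale (e (suc i)) (⋆-head (c i) k)

  -- The (t²-t)-term of the first column is exactly what the remaining columns leave over
  -- (induction); the rest cancels by the recurrence.
  heads-collapse : ∀ e → Recurrent e → (c : ℕ → ℕ) → (∀ i → c (suc i) ≡ c i +ℕ a) → ∀ m →
    scale (e 0) (t²-tTerm (c 0) m) ++ antidiagonal (suc m) (weightedHead e c)
      ≋ scale (e 1) (word (c 0 ∷ aⁿ m))
  heads-collapse e e-rec c c-step zero =
    ++-cong {scale (e 0) []} {[]} (scale-[] (e 0)) (≡⇒≋ (++-identityʳ (scale (e 1) (word (c 0 ∷ [])))))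
  heads-collapse e e-rec c c-step (suc m) = begin
    e₀QX ++ (scale (e 1) (P ++ (OX ++ T)) ++ R)
      ≈⟨ ++-congˡ e₀QX (++-congʳ R
           (≋-trans (scale-++ (e 1) P (OX ++ T)) (++-congˡ e₁P (scale-++ (e 1) OX T)))) ⟩
    e₀QX ++ ((e₁P ++ (e₁OX ++ e₁T)) ++ R)
      ≡⟨ cong (e₀QX ++_) (trans (++-assoc e₁P _ R) (cong (e₁P ++_) (++-assoc e₁OX e₁T R))) ⟩
    e₀QX ++ (e₁P ++ (e₁OX ++ (e₁T ++ R)))
      ≈⟨ ++-congˡ e₀QX (++-congˡ e₁P (++-congˡ e₁OX next-collapse)) ⟩
    e₀QX ++ (e₁P ++ (e₁OX ++ e₂X))
      ≈⟨ x∙yz≈y∙xz e₀QX e₁P (e₁OX ++ e₂X) ⟩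
    e₁P ++ (e₀QX ++ (e₁OX ++ e₂X))
      ≈⟨ ++-congˡ e₁P (recurrent-scale {e} e-rec 0 X) ⟩
    e₁P ++ []
      ≡⟨ ++-identityʳ e₁P ⟩
    e₁P ∎
    where
    open ≈-Reasoning ≋-setoid
    X = word (c 0 +ℕ a ∷ aⁿ m)
    P = word (c 0 ∷ aⁿ (suc m))
    OX = scale oneMinus2t X
    T = t²-tTerm (c 0 +ℕ a) m
    R = antidiagonal (suc m) (weightedHead (e ∘ suc) (c ∘ suc))
    e₀QX = scale (e 0) (scale t²-t X)
    e₁P = scale (e 1) P
    e₁OX = scale (e 1) OX
    e₁T = scale (e 1) T
    e₂X = scale (e 2) X
    next-collapse : e₁T ++ R ≋ e₂X
    next-collapse = subst (λ c₁ → scale (e 1) (t²-tTerm c₁ m) ++ R ≋ scale (e 2) (word (c₁ ∷ aⁿ m)))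
                        (c-step 0) (heads-collapse (e ∘ suc) (e-rec ∘ suc) (c ∘ suc) (c-step ∘ suc) m)

  lhsTerm : ℕ → ℕ → ℕ → Poly
  lhsTerm b i k = scale (d (suc i)) ((b +ℕ i *ℕ a ∷ []) ⋆ aⁿ k)

  dHead : ℕ → ℕ → ℕ → Poly
  dHead b = weightedHead d (λ i → b +ℕ i *ℕ a)

  lhs-step : ∀ b n → lhs a b (suc n) ≋ pre (z a) (lhs a b n) ++ antidiagonal (suc n) (dHead b)
  lhs-step b n = antidiagonal-step (z a) {lhsTerm b} {dHead b} (λ i → ≋-refl) term-step n
    where
    open ≈-Reasoning ≋-setoid
    term-step : ∀ i k → lhsTerm b i (suc k) ≋ pre (z a) (lhsTerm b i k) ++ dHead b i (suc k)
    term-step i k = begin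
      scale D (F (suc k))                           ≈⟨ scale-cong D (⋆-step c k) ⟩
      scale D (pre (z a) (F k) ++ H)                ≈⟨ scale-++ D (pre (z a) (F k)) H ⟩
      scale D (pre (z a) (F k)) ++ scale D H        ≈⟨ ++-congʳ (scale D H) (pre-scale (z a) D (F k)) ⟨
      pre (z a) (scale D (F k)) ++ scale D H        ∎
      where
      c = b +ℕ i *ℕ a
      D = d (suc i)
      F = λ k → (c ∷ []) ⋆ aⁿ k
      H = ⋆-head c (suc k)

  d-heads-collapse : ∀ b n → antidiagonal (suc n) (dHead b) ≋ word (b ∷ aⁿ n)
  d-heads-collapse b n = begin
    antidiagonal (suc n) (dHead b)
      ≈⟨ ++-congʳ (antidiagonal (suc n) (dHead b)) (scale-d0 (t²-tTerm (b +ℕ 0) n)) ⟨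
    scale (d 0) (t²-tTerm (b +ℕ 0) n) ++ antidiagonal (suc n) (dHead b)
      ≈⟨ heads-collapse d d-recurrent (λ i → b +ℕ i *ℕ a) progression n ⟩
    scale (d 1) (word (b +ℕ 0 ∷ aⁿ n))
      ≈⟨ scale-d1 (word (b +ℕ 0 ∷ aⁿ n)) ⟩
    word (b +ℕ 0 ∷ aⁿ n)
      ≡⟨ cong (λ c → word (c ∷ aⁿ n)) (ℕ.+-identityʳ b) ⟩
    word (b ∷ aⁿ n) ∎
    where
    open ≈-Reasoning ≋-setoid
    progression : ∀ i → b +ℕ suc i *ℕ a ≡ b +ℕ i *ℕ a +ℕ a
    progression i = trans (cong (b +ℕ_) (ℕ.+-comm a (i *ℕ a))) (sym (ℕ.+-assoc b (i *ℕ a) a))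

  rhs-step : ∀ b n → rhs a b (suc n) ≡ word (b ∷ aⁿ n) ++ pre (z a) (rhs a b n)
  rhs-step b n = cong (word (b ∷ aⁿ n) ++_) (sym (pre-Σ (z a) shift-index n))
    where
    shift-index : ∀ m → pre (z a) (word (replicate m a ++ (b ∷ []) ++ replicate (n ∸ℕ 1 ∸ℕ m) a))
                       ≡ word (a ∷ replicate m a ++ (b ∷ []) ++ replicate (n ∸ℕ suc m) a)
    shift-index m =
      cong (λ k → word (a ∷ replicate m a ++ (b ∷ []) ++ replicate k a)) (ℕ.∸-+-assoc n 1 m)

  harmonic-identity : ∀ b n → lhs a b n ≋ rhs a b n
  harmonic-identity b zero = ≋-refl
  harmonic-identity b (suc n) = begin
    lhs a b (suc n)
      ≈⟨ lhs-step b n ⟩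
    pre (z a) (lhs a b n) ++ antidiagonal (suc n) (dHead b)
      ≈⟨ ++-cong (pre-cong (z a) (harmonic-identity b n)) (d-heads-collapse b n) ⟩
    pre (z a) (rhs a b n) ++ word (b ∷ aⁿ n)
      ≈⟨ ++-comm (pre (z a) (rhs a b n)) (word (b ∷ aⁿ n)) ⟩
    word (b ∷ aⁿ n) ++ pre (z a) (rhs a b n)
      ≡⟨ rhs-step b n ⟨
    rhs a b (suc n) ∎
    where open ≈-Reasoning ≋-setoid

mainTheorem16 : (a b n : ℕ) → 1 ≤ a → 1 ≤ b → 1 ≤ n → lhs a b n ≈ rhs a b n
mainTheorem16 a b n 1≤a _ _ j w = coeffs-≗ (HarmonicProduct.harmonic-identity a 1≤a b n) w j
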